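{- For each $n\ge 3$ there is a tight irreducible subcube partition of $\{0,1\}^n$ whose weight vector is $(1,n,n-3,1,0,\dots,0)$.
   Context: Subcubes of $\{0,1\}^n$ are identified with words in $\{0,1,*\}^n$. A subcube partition of length $n$ is a partition of $\{0,1\}^n$ into subcubes. It is irreducible if no subset $G$ with $1<|G|<|F|$ has a union that is a subcube; tight if every coordinate $i$ has some subcube $s$ with $s_i\ne*$. The weight of a subcube is the number of $1$s in its word. The weight vector of $F$ is $(w_0,\dots,w_n)$ where $w_h$ is the number of subcubes of $F$ of weight $h$. -}

module Defs where

open import Data.Nat using (ℕ; zero; suc; _<_; _∸_)
open import Data.Bool using (Bool; true; false)
open import Data.Fin using (Fin; toℕ)
open import Data.Fin.Subset using (Subset; _∈_; ∣_∣)
open import Data.Vec using (Vec; []; _∷_; lookup; tabulate)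
open import Data.List using (List; length; filter)
import Data.List as List
open import Data.Product using (Σ; ∃; _×_)
open import Data.Unit using (⊤)
open import Data.Empty using (⊥)
open import Relation.Nullary using (¬_)
open import Relation.Binary.PropositionalEquality using (_≡_; _≢_)
open import Function.Bundles using (_⇔_)

data Sym : Set where
  𝟘 𝟙 ⋆ : Sym

-- A subcube of {0,1}^n, as a word in {0,1,*}^n
Cube : ℕ → Set
Cube n = Vec Sym n

Point : ℕ → Set
Point n = Vec Bool n

matches : Bool → Sym → Set
matches false 𝟘 = ⊤
matches false 𝟙 = ⊥
matches true  𝟘 = ⊥
matches true  𝟙 = ⊤
matches _     ⋆ = ⊤

_∈C_ : ∀ {n} → Point n → Cube n → Set
x ∈C s = ∀ i → matches (lookup x i) (lookup s i)

member : ∀ {n} (F : List (Cube n)) → Fin (length F) → Cube n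
member F i = List.lookup F i

-- F is a partition of {0,1}^n: every point lies in exactly one member
-- (this forces the members to be pairwise disjoint, hence distinct)
IsPartition : ∀ {n} → List (Cube n) → Set
IsPartition {n} F =
  ∀ (x : Point n) → Σ (Fin (length F)) λ i →
    (x ∈C member F i) × (∀ j → x ∈C member F j → j ≡ i)

UnionIsSubcube : ∀ {n} (F : List (Cube n)) → Subset (length F) → Set
UnionIsSubcube {n} F G =
  Σ (Cube n) λ s → ∀ (x : Point n) →
    (x ∈C s) ⇔ (Σ (Fin (length F)) λ i → (i ∈ G) × (x ∈C member F i))

Irreducible : ∀ {n} → List (Cube n) → Set
Irreducible F =
  ∀ (G : Subset (length F)) → 1 < ∣ G ∣ → ∣ G ∣ < length F → ¬ UnionIsSubcube F G

Tight : ∀ {n} → List (Cube n) → Set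
Tight {n} F = ∀ (i : Fin n) → Σ (Fin (length F)) λ j → lookup (member F j) i ≢ ⋆

weight : ∀ {n} → Cube n → ℕ
weight [] = 0
weight (𝟙 ∷ s) = suc (weight s)
weight (𝟘 ∷ s) = weight s
weight (⋆ ∷ s) = weight s

countWeight : ∀ {n} → List (Cube n) → ℕ → ℕ
countWeight F h = length (filter (λ s → weight s Data.Nat.≟ h) F)

weightVector : ∀ {n} → List (Cube n) → Vec ℕ (suc n)
weightVector {n} F = tabulate λ (h : Fin (suc n)) → countWeight F (toℕ h)

target : ℕ → ℕ → ℕ
target n 0 = 1
target n 1 = n
target n 2 = n ∸ 3
target n 3 = 1
target n (suc (suc (suc (suc _)))) = 0

-- Write k = m + 1 and n = m + 3.  The tails 0ᵏ, 0ᵐ1 and the m cubes 0ʲ1⋆ᵐ⁻ʲ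
-- partition {0,1}ᵏ; the family consists of P = 10⋆ᵏ together with, over each tail,
-- two cubes whose first two letters partition {00, 01, 11}.  For irreducibility, the union S of a
-- subfamily which is a subcube is closed under coordinatewise mixing of points and
-- contains every member of F it meets.  Every member other than P contains a point
-- starting with 00 or one starting with 11, and two distinct members of the same
-- kind force, by mixing and saturation, a point of the other kind; a 00-point and
-- an 11-point mix into P.  From P and a point outside P one reaches 01 0ᵏ, and every
-- point is a mix of 01 0ᵏ and its complement 10 1ᵏ ∈ P, so S is the whole cube.

module Submission where

open import Defs
open import Data.Nat using (ℕ; zero; suc; _+_; _∸_; _≤_; _<_; s≤s; _≡ᵇ_; _≟_)
open import Data.Nat.Properties using (+-identityʳ; <⇒≱; ≡ᵇ⇒≡; ≡⇒≡ᵇ)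
open import Data.Bool using (true; false; not; if_then_else_; T)
open import Data.Fin using (Fin; toℕ; zero; suc)
open import Data.Fin.Properties using (suc-injective)
open import Data.Fin.Subset using (Subset; _∈_; ∣_∣; ⊤)
open import Data.Fin.Subset.Properties using (p⊆q⇒∣p∣≤∣q∣; ∣⊤∣≡n)
open import Data.Vec using ([]; _∷_; replicate; _∷ʳ_; tabulate; lookup; map; here; there)
open import Data.Vec.Properties using (tabulate-cong; lookup-replicate)
open import Data.List using (List; []; _∷_; _++_; length; filter)
import Data.List as List
open import Data.List.Properties using (filter-++; length-++; filter-all; filter-none; length-map)
open import Data.List.Membership.Propositional using (lose) renaming (_∈_ to _∈ˡ_)
open import Data.List.Membership.Propositional.Properties using (∈-map⁺; ∈-map⁻; ∈-++⁺ˡ; ∈-++⁺ʳ; ∈-++⁻; ∈-lookup)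
open import Data.List.Relation.Unary.Any as Any using (Any; here; there)
open import Data.List.Relation.Unary.Any.Properties using (lookup-index)
open import Data.List.Relation.Unary.All as All using (All; []; _∷_)
import Data.List.Relation.Unary.All.Properties as All
open import Data.List.Relation.Unary.AllPairs as AllPairs using (AllPairs; []; _∷_)
import Data.List.Relation.Unary.AllPairs.Properties as AllPairs
open import Data.Product using (Σ; Σ-syntax; _×_; _,_; proj₂)
open import Data.Sum using (_⊎_; inj₁; inj₂)
open import Data.Unit using (tt) renaming (⊤ to Unit)
open import Data.Empty using (⊥; ⊥-elim)
open import Function using (_∘_)
open import Function.Bundles using (Equivalence)
open import Relation.Binary.PropositionalEquality using (_≡_; _≢_; refl; sym; trans; cong; subst)

infix 4 _∈ᵛ_

_∈ᵛ_ : ∀ {k} → Point k → Cube k → Set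
[]      ∈ᵛ []      = Unit
(b ∷ x) ∈ᵛ (c ∷ s) = matches b c × x ∈ᵛ s

∈ᵛ⇒∈C : ∀ {k} {x : Point k} {s} → x ∈ᵛ s → x ∈C s
∈ᵛ⇒∈C {x = _ ∷ _} {_ ∷ _} (b∈c , _)   zero    = b∈c
∈ᵛ⇒∈C {x = _ ∷ _} {_ ∷ _} (_   , x∈s) (suc i) = ∈ᵛ⇒∈C x∈s i

∈C⇒∈ᵛ : ∀ {k} {x : Point k} {s} → x ∈C s → x ∈ᵛ s
∈C⇒∈ᵛ {x = []}    {[]}    _   = tt
∈C⇒∈ᵛ {x = _ ∷ _} {_ ∷ _} x∈s = x∈s zero , ∈C⇒∈ᵛ (x∈s ∘ suc)

∈ᵛ-stars : ∀ {k} (x : Point k) → x ∈ᵛ replicate k ⋆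
∈ᵛ-stars []          = tt
∈ᵛ-stars (false ∷ x) = tt , ∈ᵛ-stars x
∈ᵛ-stars (true  ∷ x) = tt , ∈ᵛ-stars x

∈ᵛ-replicate : ∀ {b c} k → matches b c → replicate k b ∈ᵛ replicate k c
∈ᵛ-replicate zero    _   = tt
∈ᵛ-replicate (suc k) b∈c = b∈c , ∈ᵛ-replicate k b∈c

∈ᵛ-∷ʳ : ∀ {k b c} {x : Point k} {s} → x ∈ᵛ s → matches b c → x ∷ʳ b ∈ᵛ s ∷ʳ c
∈ᵛ-∷ʳ {x = []}    {[]}    _          b∈c = b∈c , tt
∈ᵛ-∷ʳ {x = _ ∷ _} {_ ∷ _} (h , x∈s) b∈c = h , ∈ᵛ-∷ʳ x∈s b∈c

sample : ∀ {k} → Cube k → Point k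
sample []      = []
sample (𝟘 ∷ s) = false ∷ sample s
sample (𝟙 ∷ s) = true  ∷ sample s
sample (⋆ ∷ s) = false ∷ sample s

sample-∈ᵛ : ∀ {k} (s : Cube k) → sample s ∈ᵛ s
sample-∈ᵛ []      = tt
sample-∈ᵛ (𝟘 ∷ s) = tt , sample-∈ᵛ s
sample-∈ᵛ (𝟙 ∷ s) = tt , sample-∈ᵛ s
sample-∈ᵛ (⋆ ∷ s) = tt , sample-∈ᵛ s

-- A set of points is a subcube exactly when it is nonempty and closed under mixing.
data Mix : ∀ {k} → Point k → Point k → Point k → Set where
  mix[] : Mix [] [] []
  pick₁ : ∀ {k a b} {x y z : Point k} → Mix x y z → Mix (a ∷ x) (b ∷ y) (a ∷ z)
  pick₂ : ∀ {k a b} {x y z : Point k} → Mix x y z → Mix (a ∷ x) (b ∷ y) (b ∷ z)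

mix-left : ∀ {k} {x y : Point k} → Mix x y x
mix-left {x = []}    {[]}    = mix[]
mix-left {x = _ ∷ _} {_ ∷ _} = pick₁ mix-left

mix-right : ∀ {k} {x y : Point k} → Mix x y y
mix-right {x = []}    {[]}    = mix[]
mix-right {x = _ ∷ _} {_ ∷ _} = pick₂ mix-right

mix-complement : ∀ {k} (x y : Point k) → Mix x (map not x) y
mix-complement []          []          = mix[]
mix-complement (false ∷ x) (false ∷ y) = pick₁ (mix-complement x y)
mix-complement (false ∷ x) (true  ∷ y) = pick₂ (mix-complement x y)
mix-complement (true  ∷ x) (false ∷ y) = pick₂ (mix-complement x y)
mix-complement (true  ∷ x) (true  ∷ y) = pick₁ (mix-complement x y)

∈ᵛ-mix : ∀ {k} {x y z : Point k} {s} → x ∈ᵛ s → y ∈ᵛ s → Mix x y z → z ∈ᵛ s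
∈ᵛ-mix {s = []}    _          _          mix[]     = tt
∈ᵛ-mix {s = _ ∷ _} (h , x∈s) (_ , y∈s) (pick₁ m) = h , ∈ᵛ-mix x∈s y∈s m
∈ᵛ-mix {s = _ ∷ _} (_ , x∈s) (h , y∈s) (pick₂ m) = h , ∈ᵛ-mix x∈s y∈s m

Disjoint : ∀ {k} → Cube k → Cube k → Set
Disjoint s t = ∀ {x} → x ∈ᵛ s → x ∈ᵛ t → ⊥

disjoint-irrefl : ∀ {k} {s : Cube k} → Disjoint s s → ⊥
disjoint-irrefl {s = s} s#s = s#s (sample-∈ᵛ s) (sample-∈ᵛ s)

data Clash : ∀ {k} → Cube k → Cube k → Set where
  here₀₁ : ∀ {k} {s t : Cube k} → Clash (𝟘 ∷ s) (𝟙 ∷ t)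
  here₁₀ : ∀ {k} {s t : Cube k} → Clash (𝟙 ∷ s) (𝟘 ∷ t)
  skip   : ∀ {k a b} {s t : Cube k} → Clash s t → Clash (a ∷ s) (b ∷ t)

clash-sym : ∀ {k} {s t : Cube k} → Clash s t → Clash t s
clash-sym here₀₁   = here₁₀
clash-sym here₁₀   = here₀₁
clash-sym (skip c) = skip (clash-sym c)

clash⇒disjoint : ∀ {k} {s t : Cube k} → Clash s t → Disjoint s t
clash⇒disjoint here₀₁ {false ∷ _} _ (() , _)
clash⇒disjoint here₀₁ {true  ∷ _} (() , _) _
clash⇒disjoint here₁₀ {false ∷ _} (() , _) _
clash⇒disjoint here₁₀ {true  ∷ _} _ (() , _)
clash⇒disjoint (skip c) {_ ∷ _} (_ , x∈s) (_ , x∈t) = clash⇒disjoint c x∈s x∈t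

index-unique : ∀ {n x} {F : List (Cube n)} → AllPairs Disjoint F → (x∈F : Any (x ∈ᵛ_) F) →
               ∀ j → x ∈ᵛ List.lookup F j → j ≡ Any.index x∈F
index-unique _        (here _)  zero    _   = refl
index-unique (d ∷ _)  (here p)  (suc j) x∈j = ⊥-elim (All.lookup d (∈-lookup j) p x∈j)
index-unique (d ∷ _)  (there a) zero    x∈j =
  ⊥-elim (All.lookup d (∈-lookup (Any.index a)) x∈j (lookup-index a))
index-unique (_ ∷ ds) (there a) (suc j) x∈j = cong suc (index-unique ds a j x∈j)

isPartition : ∀ {n} {F : List (Cube n)} → (∀ x → Any (x ∈ᵛ_) F) → AllPairs Disjoint F → IsPartition F
isPartition cover disjoint x =
  Any.index (cover x) , ∈ᵛ⇒∈C (lookup-index (cover x)) ,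
  λ j x∈j → index-unique disjoint (cover x) j (∈C⇒∈ᵛ x∈j)

partition-unique : ∀ {n} {F : List (Cube n)} → IsPartition F →
                   ∀ x {i j} → x ∈C member F i → x ∈C member F j → i ≡ j
partition-unique part x x∈i x∈j =
  trans (proj₂ (proj₂ (part x)) _ x∈i) (sym (proj₂ (proj₂ (part x)) _ x∈j))

MixClosed : ∀ {n} → (Point n → Set) → Set
MixClosed S = ∀ {x y z} → S x → S y → Mix x y z → S z

Saturated : ∀ {n} → List (Cube n) → (Point n → Set) → Set
Saturated F S = ∀ {c x y} → c ∈ˡ F → x ∈ᵛ c → y ∈ᵛ c → S x → S y

infix 4 _⊆ᵖ_

_⊆ᵖ_ : ∀ {n} → Cube n → (Point n → Set) → Set
c ⊆ᵖ S = ∀ x → x ∈ᵛ c → S x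

-- The union of a subfamily of a partition F which is a subcube is mix-closed and F-saturated.
Spanning : ∀ {n} → List (Cube n) → Set₁
Spanning {n} F =
  ∀ (S : Point n → Set) → MixClosed S → Saturated F S →
  ∀ {c₁ c₂} → c₁ ∈ˡ F → c₂ ∈ˡ F → Disjoint c₁ c₂ → c₁ ⊆ᵖ S → c₂ ⊆ᵖ S → ∀ x → S x

two-distinct-elements : ∀ {k} (G : Subset k) → 1 < ∣ G ∣ → Σ[ i ∈ Fin k ] Σ[ j ∈ Fin k ] i ∈ G × j ∈ G × i ≢ j
two-distinct-elements (true  ∷ G) (s≤s 0<∣G∣) =
  let j , j∈G = element G 0<∣G∣ in zero , suc j , here , there j∈G , λ ()
  where
  element : ∀ {k} (G : Subset k) → 0 < ∣ G ∣ → Σ[ i ∈ Fin k ] i ∈ G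
  element (true  ∷ G) _       = zero , here
  element (false ∷ G) 0<∣G∣ = let i , i∈G = element G 0<∣G∣ in suc i , there i∈G
two-distinct-elements (false ∷ G) 1<∣G∣ =
  let i , j , i∈G , j∈G , i≢j = two-distinct-elements G 1<∣G∣
  in suc i , suc j , there i∈G , there j∈G , i≢j ∘ suc-injective

spanning⇒irreducible : ∀ {n} {F : List (Cube n)} → IsPartition F → Spanning F → Irreducible F
spanning⇒irreducible {n} {F} part spanning G 1<∣G∣ ∣G∣<∣F∣ (s , s≡⋃G) =
  <⇒≱ ∣G∣<∣F∣ (subst (_≤ ∣ G ∣) (∣⊤∣≡n _) (p⊆q⇒∣p∣≤∣q∣ {p = ⊤} (λ {j} _ → every-index-in-G j)))
  where
  S : Point n → Set
  S x = x ∈ᵛ s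

  toG : ∀ {x} → S x → Σ[ i ∈ Fin (length F) ] i ∈ G × x ∈C member F i
  toG {x} = Equivalence.to (s≡⋃G x) ∘ ∈ᵛ⇒∈C

  fromG : ∀ {i} → i ∈ G → member F i ⊆ᵖ S
  fromG {i} i∈G x x∈i = ∈C⇒∈ᵛ (Equivalence.from (s≡⋃G x) (i , i∈G , ∈ᵛ⇒∈C x∈i))

  saturated : Saturated F S
  saturated {c} {x} {y} c∈F x∈c y∈c Sx =
    let i , i∈G , x∈i = toG Sx
        c≡i = partition-unique {F = F} part x (∈ᵛ⇒∈C (subst (x ∈ᵛ_) (lookup-index c∈F) x∈c)) x∈i
    in fromG (subst (_∈ G) (sym c≡i) i∈G) y (subst (y ∈ᵛ_) (lookup-index c∈F) y∈c)

  full : ∀ x → S x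
  full =
    let i , j , i∈G , j∈G , i≢j = two-distinct-elements G 1<∣G∣
    in spanning S ∈ᵛ-mix saturated (∈-lookup i) (∈-lookup j)
         (λ {x} x∈i x∈j → i≢j (partition-unique {F = F} part x (∈ᵛ⇒∈C x∈i) (∈ᵛ⇒∈C x∈j)))
         (fromG i∈G) (fromG j∈G)

  every-index-in-G : ∀ j → j ∈ G
  every-index-in-G j =
    let x         = sample (member F j)
        i , i∈G , x∈i = toG (full x)
        j≡i = partition-unique {F = F} part x (∈ᵛ⇒∈C (sample-∈ᵛ (member F j))) x∈i
    in subst (_∈ G) (sym j≡i) i∈G

countWeight-++ : ∀ {k} (xs ys : List (Cube k)) h → countWeight (xs ++ ys) h ≡ countWeight xs h + countWeight ys h
countWeight-++ xs ys h =
  trans (cong length (filter-++ (λ s → weight s ≟ h) xs ys)) (length-++ (filter _ xs))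

countWeight-uniform : ∀ {k w} {xs : List (Cube k)} h → All (λ c → weight c ≡ w) xs →
                      countWeight xs h ≡ (if w ≡ᵇ h then length xs else 0)
countWeight-uniform {w = w} h ws with w ≡ᵇ h in eq
... | true  with refl ← ≡ᵇ⇒≡ w h (subst T (sym eq) tt) =
  cong length (filter-all (λ s → weight s ≟ h) ws)
... | false = cong length (filter-none (λ s → weight s ≟ h) (All.map (λ {c} → weight≢h {c}) ws))
  where
  weight≢h : ∀ {c} → weight c ≡ w → weight c ≢ h
  weight≢h c≡w c≡h = subst T eq (≡⇒≡ᵇ w h (trans (sym c≡w) c≡h))

countWeight-target : ∀ {k} n (xs₀ xs₁ xs₂ xs₃ : List (Cube k)) →
  All (λ c → weight c ≡ 0) xs₀ → All (λ c → weight c ≡ 1) xs₁ →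
  All (λ c → weight c ≡ 2) xs₂ → All (λ c → weight c ≡ 3) xs₃ →
  length xs₀ ≡ 1 → length xs₁ ≡ n → length xs₂ ≡ n ∸ 3 → length xs₃ ≡ 1 →
  ∀ h → countWeight (xs₀ ++ xs₁ ++ xs₂ ++ xs₃) h ≡ target n h
countWeight-target n xs₀ xs₁ xs₂ xs₃ w₀ w₁ w₂ w₃ l₀ l₁ l₂ l₃ h
  rewrite countWeight-++ xs₀ (xs₁ ++ xs₂ ++ xs₃) h | countWeight-++ xs₁ (xs₂ ++ xs₃) h
        | countWeight-++ xs₂ xs₃ h
        | countWeight-uniform h w₀ | countWeight-uniform h w₁ | countWeight-uniform h w₂
        | countWeight-uniform h w₃ | l₀ | l₁ | l₂ | l₃ = by-weight h
  where
  by-weight : ∀ h → (if 0 ≡ᵇ h then 1 else 0) + ((if 1 ≡ᵇ h then n else 0)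
                  + ((if 2 ≡ᵇ h then n ∸ 3 else 0) + (if 3 ≡ᵇ h then 1 else 0)))
                  ≡ target n h
  by-weight 0 = refl
  by-weight 1 = +-identityʳ n
  by-weight 2 = +-identityʳ (n ∸ 3)
  by-weight 3 = refl
  by-weight (suc (suc (suc (suc _)))) = refl

weight-zeros : ∀ k → weight (replicate k 𝟘) ≡ 0
weight-zeros zero    = refl
weight-zeros (suc k) = weight-zeros k

weight-stars : ∀ k → weight (replicate k ⋆) ≡ 0
weight-stars zero    = refl
weight-stars (suc k) = weight-stars k

weight-lastOne : ∀ m → weight (replicate m 𝟘 ∷ʳ 𝟙) ≡ 1
weight-lastOne zero    = refl
weight-lastOne (suc m) = weight-lastOne m

clash-zeros-lastOne : ∀ m → Clash (replicate (suc m) 𝟘) (replicate m 𝟘 ∷ʳ 𝟙)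
clash-zeros-lastOne zero    = here₀₁
clash-zeros-lastOne (suc m) = skip (clash-zeros-lastOne m)

-- The cube 0ʲ1⋆ᵐ⁻ʲ of the words in {0,1}ᵐ⁺¹ whose first 1 is at position j < m.
-- Together with 0ᵐ⁺¹ and 0ᵐ1 these cubes partition {0,1}ᵐ⁺¹.
data FirstOne : ∀ {m} → Cube (suc m) → Set where
  one   : ∀ {m} → FirstOne {suc m} (𝟙 ∷ replicate (suc m) ⋆)
  zero∷ : ∀ {m} {z : Cube (suc m)} → FirstOne z → FirstOne (𝟘 ∷ z)

firstOneCubes : ∀ m → List (Cube (suc m))
firstOneCubes zero    = []
firstOneCubes (suc m) = (𝟙 ∷ replicate (suc m) ⋆) ∷ List.map (𝟘 ∷_) (firstOneCubes m)

∈-firstOneCubes⁻ : ∀ {m z} → z ∈ˡ firstOneCubes m → FirstOne z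
∈-firstOneCubes⁻ {suc m} (here refl) = one
∈-firstOneCubes⁻ {suc m} (there z∈) with ∈-map⁻ (𝟘 ∷_) z∈
... | _ , z′∈ , refl = zero∷ (∈-firstOneCubes⁻ z′∈)

length-firstOneCubes : ∀ m → length (firstOneCubes m) ≡ m
length-firstOneCubes zero    = refl
length-firstOneCubes (suc m) = cong suc (trans (length-map (𝟘 ∷_) (firstOneCubes m)) (length-firstOneCubes m))

length-map-firstOneCubes : ∀ {m} {A : Set} (f : Cube (suc m) → A) → length (List.map f (firstOneCubes m)) ≡ m
length-map-firstOneCubes {m} f = trans (length-map f (firstOneCubes m)) (length-firstOneCubes m)

firstOneCubes-cover : ∀ m (w : Point (suc m)) →
  w ≡ replicate (suc m) false ⊎ w ≡ replicate m false ∷ʳ true ⊎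
  Σ[ z ∈ Cube (suc m) ] z ∈ˡ firstOneCubes m × w ∈ᵛ z
firstOneCubes-cover zero    (false ∷ []) = inj₁ refl
firstOneCubes-cover zero    (true  ∷ []) = inj₂ (inj₁ refl)
firstOneCubes-cover (suc m) (true  ∷ w)  = inj₂ (inj₂ (_ , here refl , tt , ∈ᵛ-stars w))
firstOneCubes-cover (suc m) (false ∷ w) with firstOneCubes-cover m w
... | inj₁ refl                = inj₁ refl
... | inj₂ (inj₁ refl)         = inj₂ (inj₁ refl)
... | inj₂ (inj₂ (z , z∈ , w∈z)) = inj₂ (inj₂ (𝟘 ∷ z , there (∈-map⁺ (𝟘 ∷_) z∈) , tt , w∈z))

firstOneCubes-clash : ∀ m → AllPairs Clash (firstOneCubes m)
firstOneCubes-clash zero    = []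
firstOneCubes-clash (suc m) =
  All.map⁺ (All.tabulate (λ _ → here₁₀)) ∷ AllPairs.map⁺ (AllPairs.map skip (firstOneCubes-clash m))

all-firstOneCubes : ∀ {m} {P : Cube (suc m) → Set} → (∀ {z} → FirstOne z → P z) → All P (firstOneCubes m)
all-firstOneCubes p = All.tabulate (p ∘ ∈-firstOneCubes⁻)

weight-firstOne : ∀ {m} {z : Cube (suc m)} → FirstOne z → weight z ≡ 1
weight-firstOne (one {m}) = cong suc (weight-stars (suc m))
weight-firstOne (zero∷ f) = weight-firstOne f

clash-zeros-firstOne : ∀ {m} {z : Cube (suc m)} → FirstOne z → Clash (replicate (suc m) 𝟘) z
clash-zeros-firstOne one       = here₀₁
clash-zeros-firstOne (zero∷ f) = skip (clash-zeros-firstOne f)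

clash-lastOne-firstOne : ∀ {m} {z : Cube (suc m)} → FirstOne z → Clash (replicate m 𝟘 ∷ʳ 𝟙) z
clash-lastOne-firstOne one       = here₀₁
clash-lastOne-firstOne (zero∷ f) = skip (clash-lastOne-firstOne f)

lastOne-from-zeros : ∀ {m} {z : Cube (suc m)} → FirstOne z →
  Σ[ w ∈ Point (suc m) ] w ∈ᵛ z × Mix (replicate (suc m) false) w (replicate m false ∷ʳ true)
lastOne-from-zeros (one {m}) = true ∷ _ , (tt , ∈ᵛ-stars _) , pick₁ mix-right
lastOne-from-zeros (zero∷ f) =
  let w , w∈z , mix = lastOne-from-zeros f in false ∷ w , (tt , w∈z) , pick₁ mix

zeros-from-lastOne : ∀ {m} {z : Cube (suc m)} → FirstOne z →
  Σ[ w ∈ Point (suc m) ] w ∈ᵛ z × Mix (replicate m false ∷ʳ true) w (replicate (suc m) false)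
zeros-from-lastOne (one {m}) =
  true ∷ replicate (suc m) false , (tt , ∈ᵛ-stars (replicate (suc m) false)) , pick₁ mix-right
zeros-from-lastOne (zero∷ f) =
  let w , w∈z , mix = zeros-from-lastOne f in false ∷ w , (tt , w∈z) , pick₁ mix

lastOne-from-pair : ∀ {m} {z₁ z₂ : Cube (suc m)} → FirstOne z₁ → FirstOne z₂ →
  z₁ ≡ z₂ ⊎ Σ[ w₁ ∈ Point (suc m) ] Σ[ w₂ ∈ Point (suc m) ]
              w₁ ∈ᵛ z₁ × w₂ ∈ᵛ z₂ × Mix w₁ w₂ (replicate m false ∷ʳ true)
lastOne-from-pair one one = inj₁ refl
lastOne-from-pair one (zero∷ {z = z} _) =
  inj₂ (true ∷ _ , false ∷ sample z , (tt , ∈ᵛ-stars _) , (tt , sample-∈ᵛ z) , pick₂ mix-left)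
lastOne-from-pair (zero∷ {z = z} _) one =
  inj₂ (false ∷ sample z , true ∷ _ , (tt , sample-∈ᵛ z) , (tt , ∈ᵛ-stars _) , pick₁ mix-right)
lastOne-from-pair (zero∷ f₁) (zero∷ f₂) with lastOne-from-pair f₁ f₂
... | inj₁ refl = inj₁ refl
... | inj₂ (w₁ , w₂ , w₁∈ , w₂∈ , mix) = inj₂ (false ∷ w₁ , false ∷ w₂ , (tt , w₁∈) , (tt , w₂∈) , pick₁ mix)

-- Weights: 0 (A), 1 (B, D, P and the m cubes Q z), 2 (the m cubes R z), 3 (E).
module Construction (m : ℕ) where

  k : ℕ
  k = suc m

  Pt : Set
  Pt = Point (3 + m)

  Cb : Set
  Cb = Cube (3 + m)

  zeros lastOne : Cube k
  zeros   = replicate k 𝟘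
  lastOne = replicate m 𝟘 ∷ʳ 𝟙

  A B D E P : Cb
  A = 𝟘 ∷ 𝟘 ∷ zeros
  B = ⋆ ∷ 𝟙 ∷ zeros
  D = 𝟘 ∷ ⋆ ∷ lastOne
  E = 𝟙 ∷ 𝟙 ∷ lastOne
  P = 𝟙 ∷ 𝟘 ∷ replicate k ⋆

  Q R : Cube k → Cb
  Q z = 𝟘 ∷ 𝟘 ∷ z
  R z = ⋆ ∷ 𝟙 ∷ z

  Qs Rs : List Cb
  Qs = List.map Q (firstOneCubes m)
  Rs = List.map R (firstOneCubes m)

  F : List Cb
  F = (A ∷ []) ++ (B ∷ D ∷ P ∷ Qs) ++ Rs ++ (E ∷ [])

  A∈F : A ∈ˡ F
  A∈F = here refl

  B∈F : B ∈ˡ F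
  B∈F = there (here refl)

  D∈F : D ∈ˡ F
  D∈F = there (there (here refl))

  P∈F : P ∈ˡ F
  P∈F = there (there (there (here refl)))

  Q∈F : ∀ {z} → z ∈ˡ firstOneCubes m → Q z ∈ˡ F
  Q∈F z∈ = there (there (there (there (∈-++⁺ˡ (∈-map⁺ Q z∈)))))

  R∈F : ∀ {z} → z ∈ˡ firstOneCubes m → R z ∈ˡ F
  R∈F z∈ = there (there (there (there (∈-++⁺ʳ Qs (∈-++⁺ˡ (∈-map⁺ R z∈))))))

  E∈F : E ∈ˡ F
  E∈F = there (there (there (there (∈-++⁺ʳ Qs (∈-++⁺ʳ Rs (here refl))))))

  𝟎 ℓ : Point k
  𝟎 = replicate k false
  ℓ = replicate m false ∷ʳ true

  𝟎∈ : 𝟎 ∈ᵛ zeros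
  𝟎∈ = ∈ᵛ-replicate k tt

  ℓ∈ : ℓ ∈ᵛ lastOne
  ℓ∈ = ∈ᵛ-∷ʳ (∈ᵛ-replicate m tt) tt

  cover : ∀ x → Any (x ∈ᵛ_) F
  cover (true  ∷ false ∷ w) = lose P∈F (tt , tt , ∈ᵛ-stars w)
  cover (false ∷ false ∷ w) with firstOneCubes-cover m w
  ... | inj₁ refl                  = lose A∈F (tt , tt , 𝟎∈)
  ... | inj₂ (inj₁ refl)           = lose D∈F (tt , tt , ℓ∈)
  ... | inj₂ (inj₂ (_ , z∈ , w∈z)) = lose (Q∈F z∈) (tt , tt , w∈z)
  cover (false ∷ true  ∷ w) with firstOneCubes-cover m w
  ... | inj₁ refl                  = lose B∈F (tt , tt , 𝟎∈)
  ... | inj₂ (inj₁ refl)           = lose D∈F (tt , tt , ℓ∈)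
  ... | inj₂ (inj₂ (_ , z∈ , w∈z)) = lose (R∈F z∈) (tt , tt , w∈z)
  cover (true  ∷ true  ∷ w) with firstOneCubes-cover m w
  ... | inj₁ refl                  = lose B∈F (tt , tt , 𝟎∈)
  ... | inj₂ (inj₁ refl)           = lose E∈F (tt , tt , ℓ∈)
  ... | inj₂ (inj₂ (_ , z∈ , w∈z)) = lose (R∈F z∈) (tt , tt , w∈z)

  clashes-tail : ∀ {c} → (∀ {z} → FirstOne z → Clash c (Q z)) → (∀ {z} → FirstOne z → Clash c (R z)) →
                 Clash c E → All (Clash c) (Qs ++ Rs ++ E ∷ [])
  clashes-tail c#Q c#R c#E =
    All.++⁺ (All.map⁺ (all-firstOneCubes c#Q)) (All.++⁺ (All.map⁺ (all-firstOneCubes c#R)) (c#E ∷ []))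

  F-clash : AllPairs Clash F
  F-clash =
      (skip here₀₁ ∷ skip (skip (clash-zeros-lastOne m)) ∷ here₀₁ ∷
       clashes-tail (skip ∘ skip ∘ clash-zeros-firstOne) (λ _ → skip here₀₁) here₀₁)
    ∷ (skip (skip (clash-zeros-lastOne m)) ∷ skip here₁₀ ∷
       clashes-tail (λ _ → skip here₁₀) (skip ∘ skip ∘ clash-zeros-firstOne) (skip (skip (clash-zeros-lastOne m))))
    ∷ (here₀₁ ∷
       clashes-tail (skip ∘ skip ∘ clash-lastOne-firstOne) (skip ∘ skip ∘ clash-lastOne-firstOne) here₀₁)
    ∷ clashes-tail (λ _ → here₁₀) (λ _ → skip here₀₁) (skip here₀₁)
    ∷ tail-clash
    where
    prefixed-clash : ∀ {a b} → AllPairs Clash (List.map (λ z → a ∷ b ∷ z) (firstOneCubes m))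
    prefixed-clash = AllPairs.map⁺ (AllPairs.map (skip ∘ skip) (firstOneCubes-clash m))

    R#E : All (λ r → All (Clash r) (E ∷ [])) Rs
    R#E = All.map⁺ (all-firstOneCubes (λ f → skip (skip (clash-sym (clash-lastOne-firstOne f))) ∷ []))

    Q#RE : All (λ q → All (Clash q) (Rs ++ E ∷ [])) Qs
    Q#RE = All.map⁺ (all-firstOneCubes (λ _ → All.++⁺ (All.map⁺ (all-firstOneCubes (λ _ → skip here₀₁))) (here₀₁ ∷ [])))

    tail-clash : AllPairs Clash (Qs ++ Rs ++ E ∷ [])
    tail-clash = AllPairs.++⁺ prefixed-clash (AllPairs.++⁺ prefixed-clash ([] ∷ []) R#E) Q#RE

  F-partition : IsPartition F
  F-partition = isPartition cover (AllPairs.map clash⇒disjoint F-clash)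

  F-tight : Tight F
  F-tight i = zero , A-fixed i
    where
    A-fixed : ∀ i → lookup A i ≢ ⋆
    A-fixed zero             ()
    A-fixed (suc zero)       ()
    A-fixed (suc (suc i)) eq with trans (sym (lookup-replicate i 𝟘)) eq
    ... | ()

  F-weightVector : weightVector F ≡ tabulate (λ (h : Fin (4 + m)) → target (3 + m) (toℕ h))
  F-weightVector = tabulate-cong λ h → countWeight-target (3 + m) (A ∷ []) (B ∷ D ∷ P ∷ Qs) Rs (E ∷ [])
    (weight-zeros k ∷ [])
    (cong suc (weight-zeros k) ∷ weight-lastOne m ∷ cong suc (weight-stars k) ∷
     All.map⁺ (all-firstOneCubes weight-firstOne))
    (All.map⁺ (all-firstOneCubes (cong suc ∘ weight-firstOne)))
    (cong (2 +_) (weight-lastOne m) ∷ [])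
    refl (cong (3 +_) (length-map-firstOneCubes Q)) (length-map-firstOneCubes R) refl
    (toℕ h)

  data Low : Cb → Set where
    isA : Low A
    isD : Low D
    isQ : ∀ {z} → FirstOne z → Low (Q z)

  data High : Cb → Set where
    isB : High B
    isE : High E
    isR : ∀ {z} → FirstOne z → High (R z)

  data Member : Cb → Set where
    low  : ∀ {c} → Low c → Member c
    high : ∀ {c} → High c → Member c
    isP  : Member P

  member-view : ∀ {c} → c ∈ˡ F → Member c
  member-view (here refl)                         = low isA
  member-view (there (here refl))                 = high isB
  member-view (there (there (here refl)))         = low isD
  member-view (there (there (there (here refl)))) = isP
  member-view (there (there (there (there c∈)))) with ∈-++⁻ Qs c∈
  ... | inj₁ c∈Qs with ∈-map⁻ Q c∈Qs
  ...   | _ , z∈ , refl = low (isQ (∈-firstOneCubes⁻ z∈))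
  member-view (there (there (there (there c∈)))) | inj₂ c∈RE with ∈-++⁻ Rs c∈RE
  ... | inj₁ c∈Rs with ∈-map⁻ R c∈Rs
  ...   | _ , z∈ , refl = high (isR (∈-firstOneCubes⁻ z∈))
  member-view (there (there (there (there c∈)))) | inj₂ c∈RE | inj₂ (here refl) = high isE

  a₀ b₀ b₁ d₀ d₁ e p₀ : Pt
  a₀ = false ∷ false ∷ 𝟎
  b₀ = false ∷ true  ∷ 𝟎
  b₁ = true  ∷ true  ∷ 𝟎
  d₀ = false ∷ false ∷ ℓ
  d₁ = false ∷ true  ∷ ℓ
  e  = true  ∷ true  ∷ ℓ
  p₀ = true  ∷ false ∷ 𝟎

  a₀∈A : a₀ ∈ᵛ A
  a₀∈A = tt , tt , 𝟎∈

  b₀∈B : b₀ ∈ᵛ B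
  b₀∈B = tt , tt , 𝟎∈

  b₁∈B : b₁ ∈ᵛ B
  b₁∈B = tt , tt , 𝟎∈

  d₀∈D : d₀ ∈ᵛ D
  d₀∈D = tt , tt , ℓ∈

  d₁∈D : d₁ ∈ᵛ D
  d₁∈D = tt , tt , ℓ∈

  e∈E : e ∈ᵛ E
  e∈E = tt , tt , ℓ∈

  p₀∈P : p₀ ∈ᵛ P
  p₀∈P = tt , tt , ∈ᵛ-stars 𝟎

  low-point : ∀ {c} → Low c → Σ[ w ∈ Point k ] false ∷ false ∷ w ∈ᵛ c
  low-point isA           = 𝟎 , tt , tt , 𝟎∈
  low-point isD           = ℓ , tt , tt , ℓ∈
  low-point (isQ {z} _)   = sample z , tt , tt , sample-∈ᵛ z

  high-point : ∀ {c} → High c → Σ[ w ∈ Point k ] true ∷ true ∷ w ∈ᵛ c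
  high-point isB          = 𝟎 , tt , tt , 𝟎∈
  high-point isE          = ℓ , tt , tt , ℓ∈
  high-point (isR {z} _)  = sample z , tt , tt , sample-∈ᵛ z

  module _ (S : Pt → Set) (mix : MixClosed S) (saturate : Saturated F S) where

    contains : ∀ {c x} → c ∈ˡ F → x ∈ᵛ c → S x → c ⊆ᵖ S
    contains c∈F x∈c Sx _ y∈c = saturate c∈F x∈c y∈c Sx

    mix-tail : ∀ {a b v u} {w₁ w₂ w : Point k} →
               S (a ∷ b ∷ w₁) → S (v ∷ u ∷ w₂) → Mix w₁ w₂ w → S (a ∷ b ∷ w)
    mix-tail S₁ S₂ m = mix S₁ S₂ (pick₁ (pick₁ m))

    within-P : ∀ {w} w′ → S (true ∷ false ∷ w) → S (true ∷ false ∷ w′)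
    within-P {w} w′ S-P = contains P∈F (tt , tt , ∈ᵛ-stars w) S-P _ (tt , tt , ∈ᵛ-stars w′)

    -- Every point mixes b₀ with its complement, which lies in P.
    full-of-P-b₀ : ∀ {w} → S (true ∷ false ∷ w) → S b₀ → ∀ x → S x
    full-of-P-b₀ S-P S-b₀ x = mix S-b₀ (within-P _ S-P) (mix-complement b₀ x)

    full-of-P-x₁≡0 : ∀ {w u w′} → S (true ∷ false ∷ w) → S (false ∷ u ∷ w′) → ∀ x → S x
    full-of-P-x₁≡0 S-P S-x = full-of-P-b₀ S-P (mix-tail S-d₁ (within-P 𝟎 S-P) mix-right)
      where
      S-d₁ : S d₁
      S-d₁ = contains D∈F d₀∈D (mix S-x (within-P ℓ S-P) (pick₁ (pick₂ mix-right))) d₁ d₁∈D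

    full-of-P-x₂≡1 : ∀ {w v w′} → S (true ∷ false ∷ w) → S (v ∷ true ∷ w′) → ∀ x → S x
    full-of-P-x₂≡1 S-P S-x = full-of-P-b₀ S-P S-b₀
      where
      S-b₀ : S b₀
      S-b₀ = contains B∈F b₁∈B (mix (within-P 𝟎 S-P) S-x (pick₁ (pick₂ mix-left))) b₀ b₀∈B

    full-of-00-11 : ∀ {w w′} → S (false ∷ false ∷ w) → S (true ∷ true ∷ w′) → ∀ x → S x
    full-of-00-11 S₀₀ S₁₁ = full-of-P-x₁≡0 (mix S₁₁ S₀₀ (pick₁ (pick₂ mix-right))) S₀₀

    b₀-of-A-D : A ⊆ᵖ S → D ⊆ᵖ S → S b₀
    b₀-of-A-D S-A S-D = mix-tail (S-D d₁ d₁∈D) (S-A a₀ a₀∈A) mix-right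

    b₀-of-D-Q : ∀ {z} → FirstOne z → D ⊆ᵖ S → Q z ⊆ᵖ S → S b₀
    b₀-of-D-Q f S-D S-Q =
      let w , w∈z , m = zeros-from-lastOne f in mix-tail (S-D d₁ d₁∈D) (S-Q (false ∷ false ∷ w) (tt , tt , w∈z)) m

    D-of-A-Q : ∀ {z} → FirstOne z → A ⊆ᵖ S → Q z ⊆ᵖ S → D ⊆ᵖ S
    D-of-A-Q f S-A S-Q =
      let w , w∈z , m = lastOne-from-zeros f
      in contains D∈F d₀∈D (mix-tail (S-A a₀ a₀∈A) (S-Q (false ∷ false ∷ w) (tt , tt , w∈z)) m)

    b₀-of-low-pair : ∀ {c₁ c₂} → Low c₁ → Low c₂ → Disjoint c₁ c₂ → c₁ ⊆ᵖ S → c₂ ⊆ᵖ S → S b₀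
    b₀-of-low-pair isA     isA     c₁#c₂ _   _   = ⊥-elim (disjoint-irrefl c₁#c₂)
    b₀-of-low-pair isD     isD     c₁#c₂ _   _   = ⊥-elim (disjoint-irrefl c₁#c₂)
    b₀-of-low-pair isA     isD     _     S-A S-D = b₀-of-A-D S-A S-D
    b₀-of-low-pair isD     isA     _     S-D S-A = b₀-of-A-D S-A S-D
    b₀-of-low-pair isA     (isQ f) _     S-A S-Q = b₀-of-A-D S-A (D-of-A-Q f S-A S-Q)
    b₀-of-low-pair (isQ f) isA     _     S-Q S-A = b₀-of-A-D S-A (D-of-A-Q f S-A S-Q)
    b₀-of-low-pair isD     (isQ f) _     S-D S-Q = b₀-of-D-Q f S-D S-Q
    b₀-of-low-pair (isQ f) isD     _     S-Q S-D = b₀-of-D-Q f S-D S-Q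
    b₀-of-low-pair (isQ f₁) (isQ f₂) c₁#c₂ S-Q₁ S-Q₂ with lastOne-from-pair f₁ f₂
    ... | inj₁ refl = ⊥-elim (disjoint-irrefl c₁#c₂)
    ... | inj₂ (w₁ , w₂ , w₁∈ , w₂∈ , m) = b₀-of-D-Q f₁ (contains D∈F d₀∈D S-d₀) S-Q₁
      where
      S-d₀ : S d₀
      S-d₀ = mix-tail (S-Q₁ (false ∷ false ∷ w₁) (tt , tt , w₁∈)) (S-Q₂ (false ∷ false ∷ w₂) (tt , tt , w₂∈)) m

    d₁-of-B-R : ∀ {z} → FirstOne z → B ⊆ᵖ S → R z ⊆ᵖ S → S d₁
    d₁-of-B-R f S-B S-R =
      let w , w∈z , m = lastOne-from-zeros f in mix-tail (S-B b₀ b₀∈B) (S-R (false ∷ true ∷ w) (tt , tt , w∈z)) m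

    d₁-of-E-R : ∀ {z} → E ⊆ᵖ S → R z ⊆ᵖ S → S d₁
    d₁-of-E-R {z} S-E S-R = mix-tail (S-R (false ∷ true ∷ sample z) (tt , tt , sample-∈ᵛ z)) (S-E e e∈E) mix-right

    d₁-of-high-pair : ∀ {c₁ c₂} → High c₁ → High c₂ → Disjoint c₁ c₂ → c₁ ⊆ᵖ S → c₂ ⊆ᵖ S → S d₁
    d₁-of-high-pair isB     isB     c₁#c₂ _   _   = ⊥-elim (disjoint-irrefl c₁#c₂)
    d₁-of-high-pair isE     isE     c₁#c₂ _   _   = ⊥-elim (disjoint-irrefl c₁#c₂)
    d₁-of-high-pair isB     isE     _     S-B S-E = mix-tail (S-B b₀ b₀∈B) (S-E e e∈E) mix-right
    d₁-of-high-pair isE     isB     _     S-E S-B = mix-tail (S-B b₀ b₀∈B) (S-E e e∈E) mix-right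
    d₁-of-high-pair isB     (isR f) _     S-B S-R = d₁-of-B-R f S-B S-R
    d₁-of-high-pair (isR f) isB     _     S-R S-B = d₁-of-B-R f S-B S-R
    d₁-of-high-pair isE     (isR _) _     S-E S-R = d₁-of-E-R S-E S-R
    d₁-of-high-pair (isR _) isE     _     S-R S-E = d₁-of-E-R S-E S-R
    d₁-of-high-pair (isR f₁) (isR f₂) c₁#c₂ S-R₁ S-R₂ with lastOne-from-pair f₁ f₂
    ... | inj₁ refl = ⊥-elim (disjoint-irrefl c₁#c₂)
    ... | inj₂ (w₁ , w₂ , w₁∈ , w₂∈ , m) =
      mix-tail (S-R₁ (false ∷ true ∷ w₁) (tt , tt , w₁∈)) (S-R₂ (false ∷ true ∷ w₂) (tt , tt , w₂∈)) m

    full-of-members : ∀ {c₁ c₂} → Member c₁ → Member c₂ → Disjoint c₁ c₂ → c₁ ⊆ᵖ S → c₂ ⊆ᵖ S → ∀ x → S x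
    full-of-members (low l₁) (low l₂) c₁#c₂ S₁ S₂ =
      full-of-00-11 (S₁ _ (proj₂ (low-point l₁))) (contains B∈F b₀∈B (b₀-of-low-pair l₁ l₂ c₁#c₂ S₁ S₂) b₁ b₁∈B)
    full-of-members (high h₁) (high h₂) c₁#c₂ S₁ S₂ =
      full-of-00-11 (contains D∈F d₁∈D (d₁-of-high-pair h₁ h₂ c₁#c₂ S₁ S₂) d₀ d₀∈D) (S₁ _ (proj₂ (high-point h₁)))
    full-of-members (low l)  (high h) _ S₁ S₂ =
      full-of-00-11 (S₁ _ (proj₂ (low-point l))) (S₂ _ (proj₂ (high-point h)))
    full-of-members (high h) (low l)  _ S₁ S₂ =
      full-of-00-11 (S₂ _ (proj₂ (low-point l))) (S₁ _ (proj₂ (high-point h)))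
    full-of-members isP (low l)  _ S₁ S₂ = full-of-P-x₁≡0 (S₁ p₀ p₀∈P) (S₂ _ (proj₂ (low-point l)))
    full-of-members (low l)  isP _ S₁ S₂ = full-of-P-x₁≡0 (S₂ p₀ p₀∈P) (S₁ _ (proj₂ (low-point l)))
    full-of-members isP (high h) _ S₁ S₂ = full-of-P-x₂≡1 (S₁ p₀ p₀∈P) (S₂ _ (proj₂ (high-point h)))
    full-of-members (high h) isP _ S₁ S₂ = full-of-P-x₂≡1 (S₂ p₀ p₀∈P) (S₁ _ (proj₂ (high-point h)))
    full-of-members isP isP c₁#c₂ _ _ = ⊥-elim (disjoint-irrefl c₁#c₂)

  F-irreducible : Irreducible F
  F-irreducible = spanning⇒irreducible F-partition λ S mix saturate c₁∈F c₂∈F →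
    full-of-members S mix saturate (member-view c₁∈F) (member-view c₂∈F)

theorem2p32 : ∀ (n : ℕ) → 3 ≤ n →
    Σ (List (Cube n)) λ F →
      IsPartition F × Tight F × Irreducible F ×
      (weightVector F ≡ tabulate (λ (h : Fin (suc n)) → target n (toℕ h)))
theorem2p32 _ (s≤s (s≤s (s≤s {n = m} _))) = F , F-partition , F-tight , F-irreducible , F-weightVector
  where open Construction m
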